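{- For all $\mathcal{L}$-formulas $A$ and $B$ and every algebra $\mathbb{A}$ which is an SMA, LQMA, UQMA, DPL, APL or WSA, $$\mathbb{A}\models A\vdash B \quad\text{iff}\quad \mathbb{A}^+\models A^\tau\vdash B^\tau.$$
   Context: $\mathcal{L}$: $A ::= p \mid \top \mid \bot \mid \neg A \mid A\wedge A\mid A\vee A$ over a set of propositional variables. The multi-type language $\mathcal{L}_{MT}$ has two sorts: $\mathsf{DL}\ni A ::= p \mid \Box\alpha \mid \top\mid\bot\mid A\wedge A\mid A\vee A$ and $\mathsf{K}\ni\alpha ::= \circ A\mid 1\mid 0\mid {\sim}\alpha\mid\alpha\cup\alpha\mid\alpha\cap\alpha$. The translation $(\cdot)^\tau:\mathcal{L}\to\mathcal{L}_{MT}$ is: $p^\tau=p$, $\top^\tau=\top$, $\bot^\tau=\bot$, $(A\wedge B)^\tau=A^\tau\wedge B^\tau$, $(A\vee B)^\tau=A^\tau\vee B^\tau$, $(\neg A)^\tau=\Box{\sim}\circ A^\tau$. A semi De Morgan algebra (SMA) is an algebra $(L,\wedge,\vee,{}',\top,\bot)$ with bounded distributive lattice reduct and $\bot'=\top$, $\top'=\bot$, $(a\vee b)'=a'\wedge b'$, $(a\wedge b)''=a''\wedge b''$, $a'=a'''$; LQMA: SMA with $a\le a''$; UQMA: $a''\le a$; DPL: $a'\wedge a''=\bot$; APL: $a\wedge a'=\bot$; WSA: $a'\vee a''=\top$. For an SMA, $K=\{a'':a\in L\}$, $h(a)=a''$, $e:K\to L$ the inclusion, kernel $\mathbb{K}=(K,\cap,\cup,{}^*,1,0)$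 with $\alpha\cup\beta=h((e(\alpha)\vee e(\beta))'')$, $\alpha\cap\beta=h(e(\alpha)\wedge e(\beta))$, $1=h(\top)$, $0=h(\bot)$, $\alpha^*=h(e(\alpha)')$; and $\mathbb{A}^+=(\mathbb{L},\mathbb{K},e,h)$ with $\mathbb{L}$ the bounded lattice reduct. $\mathbb{A}\models A\vdash B$ means $v(A)\le v(B)$ for every valuation $v$ of the variables in $L$ (with $\neg$ read as ${}'$). $\mathbb{A}^+\models A^\tau\vdash B^\tau$ means the same for every valuation of the variables in $L$, where $\mathsf{DL}$-terms are interpreted in $\mathbb{L}$, $\mathsf{K}$-terms in $\mathbb{K}$, $\Box$ as $e$, $\circ$ as $h$, ${\sim}$ as ${}^*$, and the remaining connectives as the corresponding lattice operations and bounds. -}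

module Defs where

open import Level using (Level; _⊔_; suc)
open import Data.Product using (Σ; _,_; proj₁; _×_)
open import Relation.Binary using (Rel)
open import Algebra.Lattice.Bundles using (DistributiveLattice)
open import Data.Unit.Polymorphic using () renaming (⊤ to Unit)
open import Function.Bundles using (_⇔_)

record SMA (c ℓ : Level) : Set (suc (c ⊔ ℓ)) where
  field
    distLattice : DistributiveLattice c ℓ
  open DistributiveLattice distLattice public
  infix 8 _′
  field
    ⊤ₐ ⊥ₐ : Carrier
    _′    : Carrier → Carrier
    ∧-⊤ : ∀ a → (a ∧ ⊤ₐ) ≈ a
    ∨-⊥ : ∀ a → (a ∨ ⊥ₐ) ≈ a
    ′-cong : ∀ {a b} → a ≈ b → (a ′) ≈ (b ′)
    ⊥′      : (⊥ₐ ′) ≈ ⊤ₐ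
    ⊤′      : (⊤ₐ ′) ≈ ⊥ₐ
    ∨′      : ∀ a b → ((a ∨ b) ′) ≈ ((a ′) ∧ (b ′))
    ∧′′     : ∀ a b → ((a ∧ b) ′ ′) ≈ ((a ′ ′) ∧ (b ′ ′))
    ′′′     : ∀ a → (a ′) ≈ (a ′ ′ ′)

  _≤_ : Carrier → Carrier → Set ℓ
  a ≤ b = (a ∧ b) ≈ a

data Class : Set where
  SMAc LQMAc UQMAc DPLc APLc WSAc : Class

InClass : ∀ {c ℓ} → Class → SMA c ℓ → Set (c ⊔ ℓ)
InClass SMAc  𝔸 = Unit
InClass LQMAc 𝔸 = let open SMA 𝔸 in ∀ a → a ≤ (a ′ ′)
InClass UQMAc 𝔸 = let open SMA 𝔸 in ∀ a → (a ′ ′) ≤ a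
InClass DPLc  𝔸 = let open SMA 𝔸 in ∀ a → ((a ′) ∧ (a ′ ′)) ≈ ⊥ₐ
InClass APLc  𝔸 = let open SMA 𝔸 in ∀ a → (a ∧ (a ′)) ≈ ⊥ₐ
InClass WSAc  𝔸 = let open SMA 𝔸 in ∀ a → ((a ′) ∨ (a ′ ′)) ≈ ⊤ₐ

module Kernel {c ℓ} (𝔸 : SMA c ℓ) where
  open SMA 𝔸

  K : Set (c ⊔ ℓ)
  K = Σ Carrier (λ x → Σ Carrier (λ a → x ≈ (a ′ ′)))

  h : Carrier → K
  h a = (a ′ ′) , a , refl

  e : K → Carrier
  e = proj₁

  _∪ₖ_ : K → K → K
  α ∪ₖ β = h ((e α ∨ e β) ′ ′)

  _∩ₖ_ : K → K → K
  α ∩ₖ β = h (e α ∧ e β)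

  1ₖ 0ₖ : K
  1ₖ = h ⊤ₐ
  0ₖ = h ⊥ₐ

  _* : K → K
  α * = h (e α ′)

data Fm (V : Set) : Set where
  var       : V → Fm V
  ⊤f ⊥f     : Fm V
  ¬f        : Fm V → Fm V
  _∧f_ _∨f_ : Fm V → Fm V → Fm V

mutual
  data DLTm (V : Set) : Set where
    var      : V → DLTm V
    □        : KTm V → DLTm V
    ⊤d ⊥d    : DLTm V
    _∧d_ _∨d_ : DLTm V → DLTm V → DLTm V

  data KTm (V : Set) : Set where
    ∘        : DLTm V → KTm V
    1k 0k    : KTm V
    ∼        : KTm V → KTm V
    _∪k_ _∩k_ : KTm V → KTm V → KTm V

τ : ∀ {V} → Fm V → DLTm V
τ (var p)  = var p
τ ⊤f       = ⊤d
τ ⊥f       = ⊥d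
τ (¬f A)   = □ (∼ (∘ (τ A)))
τ (A ∧f B) = τ A ∧d τ B
τ (A ∨f B) = τ A ∨d τ B

module _ {c ℓ} (𝔸 : SMA c ℓ) where
  open SMA 𝔸

  ⟦_⟧ : ∀ {V} → Fm V → (V → Carrier) → Carrier
  ⟦ var p  ⟧ v = v p
  ⟦ ⊤f     ⟧ v = ⊤ₐ
  ⟦ ⊥f     ⟧ v = ⊥ₐ
  ⟦ ¬f A   ⟧ v = ⟦ A ⟧ v ′
  ⟦ A ∧f B ⟧ v = ⟦ A ⟧ v ∧ ⟦ B ⟧ v
  ⟦ A ∨f B ⟧ v = ⟦ A ⟧ v ∨ ⟦ B ⟧ v

  _⊨_⊢_ : ∀ {V} → Fm V → Fm V → Set (c ⊔ ℓ)
  _⊨_⊢_ {V} A B = (v : V → Carrier) → ⟦ A ⟧ v ≤ ⟦ B ⟧ v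

  -- 𝔸⁺ = (𝕃, 𝕂, e, h): DL-terms in 𝕃, K-terms in 𝕂
  open Kernel 𝔸

  mutual
    ⟦_⟧ᴰ : ∀ {V} → DLTm V → (V → Carrier) → Carrier
    ⟦ var p  ⟧ᴰ v = v p
    ⟦ □ α    ⟧ᴰ v = e (⟦ α ⟧ᴷ v)
    ⟦ ⊤d     ⟧ᴰ v = ⊤ₐ
    ⟦ ⊥d     ⟧ᴰ v = ⊥ₐ
    ⟦ A ∧d B ⟧ᴰ v = ⟦ A ⟧ᴰ v ∧ ⟦ B ⟧ᴰ v
    ⟦ A ∨d B ⟧ᴰ v = ⟦ A ⟧ᴰ v ∨ ⟦ B ⟧ᴰ v

    ⟦_⟧ᴷ : ∀ {V} → KTm V → (V → Carrier) → K
    ⟦ ∘ A    ⟧ᴷ v = h (⟦ A ⟧ᴰ v)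
    ⟦ 1k     ⟧ᴷ v = 1ₖ
    ⟦ 0k     ⟧ᴷ v = 0ₖ
    ⟦ ∼ α    ⟧ᴷ v = (⟦ α ⟧ᴷ v) *
    ⟦ α ∪k β ⟧ᴷ v = ⟦ α ⟧ᴷ v ∪ₖ ⟦ β ⟧ᴷ v
    ⟦ α ∩k β ⟧ᴷ v = ⟦ α ⟧ᴷ v ∩ₖ ⟦ β ⟧ᴷ v

  _⁺⊨_⊢_ : ∀ {V} → DLTm V → DLTm V → Set (c ⊔ ℓ)
  _⁺⊨_⊢_ {V} A B = (v : V → Carrier) → ⟦ A ⟧ᴰ v ≤ ⟦ B ⟧ᴰ v

module Submission where

-- The translation only changes negation, ¬A ↦ □∼∘Aᵗ, and in 𝔸⁺ the term
-- □∼∘ computes to e (h (e (h a) ′)) = a′′′′′, which equals a′ by the axiom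
-- a′ = a′′′ used twice.  Hence by induction on formulas the multi-type
-- interpretation of Aᵗ coincides (up to ≈) with the interpretation of A,
-- and the two entailment relations agree because the lattice order
-- respects ≈.

open import Defs
open import Function.Bundles using (_⇔_; mk⇔)
import Relation.Binary.Reasoning.Setoid as SetoidReasoning

module _ {c ℓ} (𝔸 : SMA c ℓ) where
  open SMA 𝔸
  open Kernel 𝔸
  open SetoidReasoning setoid

  ′⁵≈′ : ∀ a → (a ′ ′ ′ ′ ′) ≈ (a ′)
  ′⁵≈′ a = begin
    a ′ ′ ′ ′ ′  ≈⟨ ′′′ (a ′ ′) ⟨
    a ′ ′ ′      ≈⟨ ′′′ a ⟨
    a ′          ∎

  □∼∘≈′ : ∀ a → e ((h a) *) ≈ (a ′)
  □∼∘≈′ = ′⁵≈′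

  ≤-respects-≈ : ∀ {a a′ b b′} → a ≈ a′ → b ≈ b′ → a ≤ b → a′ ≤ b′
  ≤-respects-≈ {a} {a′} {b} {b′} a≈a′ b≈b′ a≤b = begin
    a′ ∧ b′  ≈⟨ ∧-cong a≈a′ b≈b′ ⟨
    a ∧ b    ≈⟨ a≤b ⟩
    a        ≈⟨ a≈a′ ⟩
    a′       ∎

  τ-faithful : ∀ {V} (A : Fm V) (v : V → Carrier) → ⟦_⟧ᴰ 𝔸 (τ A) v ≈ ⟦_⟧ 𝔸 A v
  τ-faithful (var p)  v = refl
  τ-faithful ⊤f       v = refl
  τ-faithful ⊥f       v = refl
  τ-faithful (¬f A)   v = trans (□∼∘≈′ (⟦_⟧ᴰ 𝔸 (τ A) v)) (′-cong (τ-faithful A v))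
  τ-faithful (A ∧f B) v = ∧-cong (τ-faithful A v) (τ-faithful B v)
  τ-faithful (A ∨f B) v = ∨-cong (τ-faithful A v) (τ-faithful B v)

proposition4p1 : ∀ {c ℓ} {V : Set} (A B : Fm V) (cls : Class) (𝔸 : SMA c ℓ) → InClass cls 𝔸
                 → (𝔸 ⊨ A ⊢ B) ⇔ (𝔸 ⁺⊨ τ A ⊢ τ B)
proposition4p1 A B _ 𝔸 _ = mk⇔
  (λ A⊢B v → ≤-respects-≈ 𝔸 (sym (τ-faithful 𝔸 A v)) (sym (τ-faithful 𝔸 B v)) (A⊢B v))
  (λ Aτ⊢Bτ v → ≤-respects-≈ 𝔸 (τ-faithful 𝔸 A v) (τ-faithful 𝔸 B v) (Aτ⊢Bτ v))
  where open SMA 𝔸 using (sym)
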